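{- For every $k\ge 1$, the chord diagram $U_k$ produced by the continuous growth process after $k$ steps is uniformly distributed over all $(2k-1)!!$ chord diagrams with $k$ chords on the endpoint set $[2k]$.
   Context: A chord diagram with $k$ chords on $[2k]$ is a perfect matching of the points $1,\dots,2k$ placed clockwise on a circle. Continuous growth process: start with a circle with no chords. At step $1$ a single chord is drawn, and one of its endpoints is marked as the reference endpoint. After step $k$ there are $k$ chords whose $2k$ endpoints divide the circle into $2k$ arcs. At step $k+1$ one of the $\binom{2k}{2}+2k=\binom{2k+1}{2}$ choices of either two distinct arcs or one arc taken twice is selected uniformly at random (independently of the past), and a new chord is added with one endpoint in each selected arc (both in the same arc if an arc is chosen twice); only the relative cyclic order of endpoints matters. $U_k$ is the chord diagram obtained after step $k$, with endpoints labeled $1,\dots,2k$ clockwise starting from the reference endpoint labeled $1$. -}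

module Defs where

open import Data.Nat using (ℕ; zero; suc; _+_; _*_; _∸_; _≤_; _<_; _≤ᵇ_; _≡ᵇ_)
open import Data.Bool using (if_then_else_)
open import Data.Fin using (Fin; toℕ)
open import Data.Fin.Properties using (all?)
open import Data.Product using (Σ; _×_; _,_)
open import Data.List using (List; []; _∷_; map; concatMap; upTo; length; filter)
open import Relation.Binary.PropositionalEquality using (_≡_; _≢_)
open import Relation.Nullary using (Dec)
open import Data.Nat.Properties using (_≟_)

-- A chord diagram with k chords on [2k] (points labelled 0,…,2k-1 clockwise,
-- label 0 = reference endpoint): a fixed-point-free involution of Fin (2k),
-- sending each endpoint to the other endpoint of its chord.
ChordDiagram : ℕ → Set
ChordDiagram k =
  Σ (Fin (2 * k) → Fin (2 * k)) λ f →
    (∀ p → f (f p) ≡ p) × (∀ p → f p ≢ p)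

-- Partner maps used while running the process (values outside range irrelevant).
PartnerMap : Set
PartnerMap = ℕ → ℕ

IsPerfectMatchingOn : ℕ → PartnerMap → Set
IsPerfectMatchingOn n f =
  ∀ p → p < n → (f p < n) × (f p ≢ p) × (f (f p) ≡ p)

initial : PartnerMap
initial 0 = 1
initial _ = 0

-- Arcs of a diagram with n endpoints: arc i (0 ≤ i < n) runs clockwise from
-- endpoint i to endpoint i+1 (mod n).  A choice of arcs is a pair (i , j)
-- with i ≤ j < n (i ≡ j meaning one arc taken twice); there are C(n+1,2) of them.
choices : ℕ → List (ℕ × ℕ)
choices n = concatMap (λ j → map (λ i → (i , j)) (upTo (suc j))) (upTo n)

-- Old label p ↦ new label after inserting one new endpoint in arc i and one in arc j.
shift : ℕ → ℕ → ℕ → ℕ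
shift i j p = if p ≤ᵇ i then p else (if p ≤ᵇ j then suc p else suc (suc p))

-- New label q (not a new endpoint) ↦ old label.
unshift : ℕ → ℕ → ℕ → ℕ
unshift i j q = if q ≤ᵇ i then q else (if q ≤ᵇ suc j then q ∸ 1 else q ∸ 2)

-- Add a chord with endpoints in arcs i and j (i ≤ j); the new endpoints get
-- labels i+1 and j+2; labels stay clockwise from the reference endpoint 0.
addChord : ℕ → ℕ → PartnerMap → PartnerMap
addChord i j f q =
  if q ≡ᵇ suc i then suc (suc j)
  else (if q ≡ᵇ suc (suc j) then suc i else shift i j (f (unshift i j q)))

-- The multiset of outcomes U_k over all histories of the process (each
-- history is equally likely: at each step all choices are equiprobable and
-- independent of the past).
outcomes : ℕ → List PartnerMap
outcomes zero = []
outcomes (suc zero) = initial ∷ []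
outcomes (suc (suc m)) =
  concatMap (λ f → map (λ c → addChord (Data.Product.proj₁ c) (Data.Product.proj₂ c) f)
                       (choices (2 * suc m)))
            (outcomes (suc m))

Realises : (k : ℕ) → ChordDiagram k → PartnerMap → Set
Realises k (d , _) f = ∀ (p : Fin (2 * k)) → f (toℕ p) ≡ toℕ (d p)

realises? : (k : ℕ) (D : ChordDiagram k) (f : PartnerMap) → Dec (Realises k D f)
realises? k (d , _) f = all? (λ p → f (toℕ p) ≟ toℕ (d p))

count : (k : ℕ) → ChordDiagram k → ℕ
count k D = length (filter (realises? k D) (outcomes k))

-- Count histories instead of probabilities: each step offers C(2k+1,2) equally likely
-- choices, so U_k is uniform iff every diagram arises from the same number of histories.
-- Adding a chord in arcs i ≤ j of f gives g exactly when g pairs the new endpoints i+1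
-- and j+2 and f is g with that chord removed.  So the histories ending in a diagram g with
-- k+1 chords are those ending in one of the k diagrams obtained by deleting a chord of g
-- not at the reference endpoint, and by induction every diagram arises from (k-1)! of them.
-- That g has exactly k such chords is seen by counting the right endpoints b (g b < b):
-- g swaps them with the left endpoints, so they are half of all endpoints.
module Submission where

open import Defs
open import Data.Nat using (ℕ; _≤_; _*_)
open import Data.List.Relation.Unary.All using (All)
open import Data.Product using (_×_)
open import Relation.Binary.PropositionalEquality using (_≡_)

open import Algebra.Properties.CommutativeSemigroup using (interchange)
open import Data.Bool using (true; false)
open import Data.Empty using (⊥-elim)
open import Data.Fin using (toℕ; fromℕ<)
open import Data.Fin.Properties using (toℕ<n; toℕ-fromℕ<; fromℕ<-toℕ; toℕ-injective)
open import Data.List using (List; []; _∷_; _++_; map; concatMap; applyUpTo; upTo; length; filter)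
import Data.List.Relation.Unary.All as All
open import Data.List.Relation.Unary.All.Properties using (concat⁺; map⁺; applyUpTo⁺₁)
open import Data.Nat
open import Data.Nat.Properties
open import Data.Product using (_,_; proj₁; proj₂)
open import Function using (id; _∘′_)
open import Function.Bundles using (_⇔_; mk⇔; Equivalence)
open import Relation.Binary.Definitions using (tri<; tri≈; tri>)
open import Relation.Binary.PropositionalEquality
open import Relation.Nullary using (Dec; yes; no; ¬_)
open import Relation.Nullary.Decidable using (_×-dec_; dec-true; dec-false)
open import Relation.Unary using (Decidable)
open ≡-Reasoning

𝟙 : ∀ {a} {A : Set a} → Dec A → ℕ
𝟙 (yes _) = 1
𝟙 (no _)  = 0

𝟙-yes : ∀ {a} {A : Set a} (a? : Dec A) → A → 𝟙 a? ≡ 1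
𝟙-yes (yes _) _ = refl
𝟙-yes (no ¬a) a = ⊥-elim (¬a a)

𝟙-no : ∀ {a} {A : Set a} (a? : Dec A) → ¬ A → 𝟙 a? ≡ 0
𝟙-no (yes a) ¬a = ⊥-elim (¬a a)
𝟙-no (no _)  _  = refl

𝟙-cong : ∀ {a b} {A : Set a} {B : Set b} (a? : Dec A) (b? : Dec B) → A ⇔ B → 𝟙 a? ≡ 𝟙 b?
𝟙-cong (yes a) (no ¬b) A⇔B = ⊥-elim (¬b (Equivalence.to A⇔B a))
𝟙-cong (no ¬a) (yes b) A⇔B = ⊥-elim (¬a (Equivalence.from A⇔B b))
𝟙-cong (yes _) (yes _) _ = refl
𝟙-cong (no _)  (no _)  _ = refl

𝟙-× : ∀ {a b} {A : Set a} {B : Set b} (a? : Dec A) (b? : Dec B) → 𝟙 (a? ×-dec b?) ≡ 𝟙 a? * 𝟙 b?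
𝟙-× (yes _) (yes _) = refl
𝟙-× (yes _) (no _)  = refl
𝟙-× (no _)  _       = refl

∑< : ℕ → (ℕ → ℕ) → ℕ
∑< zero    h = 0
∑< (suc n) h = ∑< n h + h n

syntax ∑< n (λ i → e) = ∑[ i < n ] e

∑<-cong : ∀ n {h h′ : ℕ → ℕ} → (∀ {p} → p < n → h p ≡ h′ p) → ∑< n h ≡ ∑< n h′
∑<-cong zero    h≗h′ = refl
∑<-cong (suc n) h≗h′ = cong₂ _+_ (∑<-cong n (h≗h′ ∘′ m<n⇒m<1+n)) (h≗h′ ≤-refl)

∑<-suc : ∀ n (h : ℕ → ℕ) → ∑[ p < suc n ] h p ≡ h 0 + ∑[ p < n ] h (suc p)
∑<-suc zero    h = sym (+-identityʳ (h 0))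
∑<-suc (suc n) h = begin
  ∑< (suc n) h + h (suc n)               ≡⟨ cong (_+ h (suc n)) (∑<-suc n h) ⟩
  h 0 + ∑[ p < n ] h (suc p) + h (suc n) ≡⟨ +-assoc (h 0) _ _ ⟩
  h 0 + ∑[ p < suc n ] h (suc p)         ∎

∑<-distrib-+ : ∀ n (h h′ : ℕ → ℕ) → ∑[ p < n ] (h p + h′ p) ≡ ∑< n h + ∑< n h′
∑<-distrib-+ zero    h h′ = refl
∑<-distrib-+ (suc n) h h′ = begin
  ∑[ p < n ] (h p + h′ p) + (h n + h′ n) ≡⟨ cong (_+ (h n + h′ n)) (∑<-distrib-+ n h h′) ⟩
  ∑< n h + ∑< n h′ + (h n + h′ n)        ≡⟨ interchange +-commutativeSemigroup (∑< n h) (∑< n h′) (h n) (h′ n) ⟩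
  ∑< n h + h n + (∑< n h′ + h′ n)        ∎

∑<-distribʳ-* : ∀ n (h : ℕ → ℕ) c → ∑[ p < n ] (h p * c) ≡ ∑< n h * c
∑<-distribʳ-* zero    h c = refl
∑<-distribʳ-* (suc n) h c = begin
  ∑[ p < n ] (h p * c) + h n * c ≡⟨ cong (_+ h n * c) (∑<-distribʳ-* n h c) ⟩
  ∑< n h * c + h n * c           ≡⟨ *-distribʳ-+ c (∑< n h) (h n) ⟨
  (∑< n h + h n) * c             ∎

∑<-zero : ∀ n → ∑[ p < n ] 0 ≡ 0
∑<-zero zero    = refl
∑<-zero (suc n) = cong (_+ 0) (∑<-zero n)

∑<-one : ∀ n → ∑[ p < n ] 1 ≡ n
∑<-one zero    = refl
∑<-one (suc n) = trans (cong (_+ 1) (∑<-one n)) (+-comm n 1)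

∑<-comm : ∀ m n (h : ℕ → ℕ → ℕ) → ∑[ a < m ] ∑[ b < n ] h a b ≡ ∑[ b < n ] ∑[ a < m ] h a b
∑<-comm zero    n h = sym (∑<-zero n)
∑<-comm (suc m) n h = begin
  ∑[ a < m ] ∑[ b < n ] h a b + ∑[ b < n ] h m b ≡⟨ cong (_+ ∑[ b < n ] h m b) (∑<-comm m n h) ⟩
  ∑[ b < n ] ∑[ a < m ] h a b + ∑[ b < n ] h m b ≡⟨ ∑<-distrib-+ n _ _ ⟨
  ∑[ b < n ] ∑[ a < suc m ] h a b               ∎

𝟙-<-suc : ∀ x n → 𝟙 (x <? suc n) ≡ 𝟙 (x <? n) + 𝟙 (x ≟ n)
𝟙-<-suc x n with <-cmp x n
... | tri< x<n x≢n _
  rewrite 𝟙-yes (x <? suc n) (m<n⇒m<1+n x<n) | 𝟙-yes (x <? n) x<n | 𝟙-no (x ≟ n) x≢n = refl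
... | tri≈ x≮n x≡n _
  rewrite 𝟙-yes (x <? suc n) (s≤s (≤-reflexive x≡n)) | 𝟙-no (x <? n) x≮n | 𝟙-yes (x ≟ n) x≡n = refl
... | tri> x≮n x≢n n<x
  rewrite 𝟙-no (x <? suc n) (<⇒≱ n<x ∘′ s≤s⁻¹) | 𝟙-no (x <? n) x≮n | 𝟙-no (x ≟ n) x≢n = refl

∑<-count : ∀ n x → ∑[ a < n ] 𝟙 (x ≟ a) ≡ 𝟙 (x <? n)
∑<-count zero    x = refl
∑<-count (suc n) x = trans (cong (_+ 𝟙 (x ≟ n)) (∑<-count n x)) (sym (𝟙-<-suc x n))

∑<-select : ∀ n x (F : ℕ → ℕ) → ∑[ a < n ] (𝟙 (x ≟ a) * F a) ≡ 𝟙 (x <? n) * F x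
∑<-select n x F = begin
  ∑[ a < n ] (𝟙 (x ≟ a) * F a) ≡⟨ ∑<-cong n (λ {a} _ → 𝟙-≟-* a) ⟩
  ∑[ a < n ] (𝟙 (x ≟ a) * F x) ≡⟨ ∑<-distribʳ-* n _ (F x) ⟩
  ∑[ a < n ] 𝟙 (x ≟ a) * F x   ≡⟨ cong (_* F x) (∑<-count n x) ⟩
  𝟙 (x <? n) * F x             ∎
  where
  𝟙-≟-* : ∀ a → 𝟙 (x ≟ a) * F a ≡ 𝟙 (x ≟ a) * F x
  𝟙-≟-* a with x ≟ a
  ... | yes refl = refl
  ... | no _     = refl

involution-swap : ∀ {n} {g : ℕ → ℕ} → (∀ {b} → b < n → g (g b) ≡ b) →
                  ∀ {a b} → a < n → b < n → g a ≡ b ⇔ g b ≡ a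
involution-swap {g = g} g-involutive a<n b<n =
  mk⇔ (λ ga≡b → trans (cong g (sym ga≡b)) (g-involutive a<n))
      (λ gb≡a → trans (cong g (sym gb≡a)) (g-involutive b<n))

∑<-select-< : ∀ {n x} → x < n → (F : ℕ → ℕ) → ∑[ a < n ] (𝟙 (x ≟ a) * F a) ≡ F x
∑<-select-< {n} {x} x<n F = begin
  ∑[ a < n ] (𝟙 (x ≟ a) * F a) ≡⟨ ∑<-select n x F ⟩
  𝟙 (x <? n) * F x             ≡⟨ cong (_* F x) (𝟙-yes (x <? n) x<n) ⟩
  1 * F x                      ≡⟨ *-identityˡ (F x) ⟩
  F x                          ∎

∑<-reindex-involution : ∀ n {g : ℕ → ℕ} → (∀ {b} → b < n → g b < n) → (∀ {b} → b < n → g (g b) ≡ b) →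
                        ∀ F → ∑[ b < n ] F (g b) ≡ ∑< n F
∑<-reindex-involution n {g} g-< g-invol F = begin
  ∑[ b < n ] F (g b)                       ≡⟨ ∑<-cong n (λ b<n → ∑<-select-< (g-< b<n) F) ⟨
  ∑[ b < n ] ∑[ a < n ] (𝟙 (g b ≟ a) * F a) ≡⟨ ∑<-comm n n _ ⟩
  ∑[ a < n ] ∑[ b < n ] (𝟙 (g b ≟ a) * F a) ≡⟨ ∑<-cong n (λ a<n → ∑<-cong n (λ b<n → cong (_* F _) (𝟙-swap b<n a<n))) ⟩
  ∑[ a < n ] ∑[ b < n ] (𝟙 (g a ≟ b) * F a) ≡⟨ ∑<-cong n (λ {a} a<n → ∑<-select-< (g-< a<n) (λ _ → F a)) ⟩
  ∑[ a < n ] F a                            ∎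
  where
  𝟙-swap : ∀ {a b} → a < n → b < n → 𝟙 (g a ≟ b) ≡ 𝟙 (g b ≟ a)
  𝟙-swap a<n b<n = 𝟙-cong (g _ ≟ _) (g _ ≟ _) (involution-swap g-invol a<n b<n)

𝟙-trichotomy : ∀ {x y} → x ≢ y → 𝟙 (x <? y) + 𝟙 (y <? x) ≡ 1
𝟙-trichotomy {x} {y} x≢y with <-cmp x y
... | tri< x<y _ _ rewrite 𝟙-yes (x <? y) x<y | 𝟙-no (y <? x) (<-asym x<y) = refl
... | tri≈ _ x≡y _ = ⊥-elim (x≢y x≡y)
... | tri> _ _ y<x rewrite 𝟙-no (x <? y) (<-asym y<x) | 𝟙-yes (y <? x) y<x = refl

∑∈ : ∀ {A : Set} → List A → (A → ℕ) → ℕ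
∑∈ []       h = 0
∑∈ (x ∷ xs) h = h x + ∑∈ xs h

syntax ∑∈ xs (λ x → e) = ∑[ x ∈ xs ] e

module _ {A : Set} where

  ∑∈-cong : ∀ (xs : List A) {h h′ : A → ℕ} → (∀ x → h x ≡ h′ x) → ∑∈ xs h ≡ ∑∈ xs h′
  ∑∈-cong []       h≗h′ = refl
  ∑∈-cong (x ∷ xs) h≗h′ = cong₂ _+_ (h≗h′ x) (∑∈-cong xs h≗h′)

  ∑∈-++ : ∀ (xs ys : List A) h → ∑∈ (xs ++ ys) h ≡ ∑∈ xs h + ∑∈ ys h
  ∑∈-++ []       ys h = refl
  ∑∈-++ (x ∷ xs) ys h = trans (cong (h x +_) (∑∈-++ xs ys h)) (sym (+-assoc (h x) _ _))

  ∑∈-distribˡ-* : ∀ (xs : List A) c h → ∑[ x ∈ xs ] (c * h x) ≡ c * ∑∈ xs h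
  ∑∈-distribˡ-* []       c h = sym (*-zeroʳ c)
  ∑∈-distribˡ-* (x ∷ xs) c h = trans (cong (c * h x +_) (∑∈-distribˡ-* xs c h)) (sym (*-distribˡ-+ c (h x) _))

  ∑∈-∑<-comm : ∀ (xs : List A) n (h : A → ℕ → ℕ) → ∑[ x ∈ xs ] ∑[ p < n ] h x p ≡ ∑[ p < n ] ∑[ x ∈ xs ] h x p
  ∑∈-∑<-comm []       n h = sym (∑<-zero n)
  ∑∈-∑<-comm (x ∷ xs) n h = trans (cong (∑< n (h x) +_) (∑∈-∑<-comm xs n h)) (sym (∑<-distrib-+ n (h x) _))

  length-filter : ∀ {P : A → Set} (P? : Decidable P) xs → length (filter P? xs) ≡ ∑[ x ∈ xs ] 𝟙 (P? x)
  length-filter P? []       = refl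
  length-filter P? (x ∷ xs) with P? x
  ... | yes _ = cong suc (length-filter P? xs)
  ... | no _  = length-filter P? xs

module _ {A B : Set} where

  ∑∈-map : ∀ (f : A → B) xs h → ∑∈ (map f xs) h ≡ ∑[ x ∈ xs ] h (f x)
  ∑∈-map f []       h = refl
  ∑∈-map f (x ∷ xs) h = cong (h (f x) +_) (∑∈-map f xs h)

  ∑∈-concatMap : ∀ (f : A → List B) xs h → ∑∈ (concatMap f xs) h ≡ ∑[ x ∈ xs ] ∑∈ (f x) h
  ∑∈-concatMap f []       h = refl
  ∑∈-concatMap f (x ∷ xs) h =
    trans (∑∈-++ (f x) (concatMap f xs) h) (cong (∑∈ (f x) h +_) (∑∈-concatMap f xs h))

∑∈-applyUpTo : ∀ {A : Set} (f : ℕ → A) n h → ∑∈ (applyUpTo f n) h ≡ ∑[ p < n ] h (f p)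
∑∈-applyUpTo f zero    h = refl
∑∈-applyUpTo f (suc n) h = trans (cong (h (f 0) +_) (∑∈-applyUpTo (f ∘′ suc) n h)) (sym (∑<-suc n (h ∘′ f)))

-- m ≤ᵇ n and m ≡ᵇ n are definitionally does (m ≤? n) and does (m ≟ n).
≤ᵇ-true : ∀ {m n} → m ≤ n → (m ≤ᵇ n) ≡ true
≤ᵇ-true {m} {n} m≤n = dec-true (m ≤? n) m≤n

≤ᵇ-false : ∀ {m n} → n < m → (m ≤ᵇ n) ≡ false
≤ᵇ-false {m} {n} n<m = dec-false (m ≤? n) (<⇒≱ n<m)

≡ᵇ-true : ∀ {m n} → m ≡ n → (m ≡ᵇ n) ≡ true
≡ᵇ-true {m} {n} m≡n = dec-true (m ≟ n) m≡n

≡ᵇ-false : ∀ {m n} → m ≢ n → (m ≡ᵇ n) ≡ false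
≡ᵇ-false {m} {n} m≢n = dec-false (m ≟ n) m≢n

data Region (a b p : ℕ) : Set where
  below   : p ≤ a → Region a b p
  between : a < p → p ≤ b → Region a b p
  above   : b < p → Region a b p

region : ∀ a b p → Region a b p
region a b p with p ≤? a | p ≤? b
... | yes p≤a | _       = below p≤a
... | no p≰a  | yes p≤b = between (≰⇒> p≰a) p≤b
... | no _    | no p≰b  = above (≰⇒> p≰b)

module _ {i j : ℕ} (i≤j : i ≤ j) where

  shift-below : ∀ {p} → p ≤ i → shift i j p ≡ p
  shift-below p≤i rewrite ≤ᵇ-true p≤i = refl

  shift-between : ∀ {p} → i < p → p ≤ j → shift i j p ≡ suc p
  shift-between i<p p≤j rewrite ≤ᵇ-false i<p | ≤ᵇ-true p≤j = refl

  shift-above : ∀ {p} → j < p → shift i j p ≡ suc (suc p)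
  shift-above j<p rewrite ≤ᵇ-false (≤-<-trans i≤j j<p) | ≤ᵇ-false j<p = refl

  unshift-below : ∀ {q} → q ≤ i → unshift i j q ≡ q
  unshift-below q≤i rewrite ≤ᵇ-true q≤i = refl

  unshift-between : ∀ {r} → i ≤ r → r ≤ j → unshift i j (suc r) ≡ r
  unshift-between i≤r r≤j rewrite ≤ᵇ-false (s≤s i≤r) | ≤ᵇ-true (s≤s r≤j) = refl

  unshift-above : ∀ {r} → j ≤ r → unshift i j (suc (suc r)) ≡ r
  unshift-above j≤r rewrite ≤ᵇ-false (s≤s (m≤n⇒m≤1+n (≤-trans i≤j j≤r))) | ≤ᵇ-false (s≤s (s≤s j≤r)) = refl

  shift-< : ∀ {n p} → p < n → shift i j p < suc (suc n)
  shift-< {p = p} p<n with region i j p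
  ... | below p≤i       rewrite shift-below p≤i       = m<n⇒m<1+n (m<n⇒m<1+n p<n)
  ... | between i<p p≤j rewrite shift-between i<p p≤j = s≤s (m<n⇒m<1+n p<n)
  ... | above j<p       rewrite shift-above j<p       = s≤s (s≤s p<n)

  shift≢1+i : ∀ p → shift i j p ≢ suc i
  shift≢1+i p eq with region i j p
  ... | below p≤i       = <⇒≢ (s≤s p≤i) (trans (sym (shift-below p≤i)) eq)
  ... | between i<p p≤j = >⇒≢ i<p (suc-injective (trans (sym (shift-between i<p p≤j)) eq))
  ... | above j<p       = >⇒≢ (s≤s (s≤s (≤-trans i≤j (<⇒≤ j<p)))) (trans (sym (shift-above j<p)) eq)

  shift≢2+j : ∀ p → shift i j p ≢ suc (suc j)
  shift≢2+j p eq with region i j p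
  ... | below p≤i       = <⇒≢ (s≤s (m≤n⇒m≤1+n (≤-trans p≤i i≤j))) (trans (sym (shift-below p≤i)) eq)
  ... | between i<p p≤j = <⇒≢ (s≤s p≤j) (suc-injective (trans (sym (shift-between i<p p≤j)) eq))
  ... | above j<p       = >⇒≢ j<p (suc-injective (suc-injective (trans (sym (shift-above j<p)) eq)))

  unshift-shift : ∀ p → unshift i j (shift i j p) ≡ p
  unshift-shift p with region i j p
  ... | below p≤i       rewrite shift-below p≤i       = unshift-below p≤i
  ... | between i<p p≤j rewrite shift-between i<p p≤j = unshift-between (<⇒≤ i<p) p≤j
  ... | above j<p       rewrite shift-above j<p       = unshift-above (<⇒≤ j<p)

  shift-injective : ∀ {p p′} → shift i j p ≡ shift i j p′ → p ≡ p′
  shift-injective {p} {p′} eq = begin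
    p                             ≡⟨ unshift-shift p ⟨
    unshift i j (shift i j p)     ≡⟨ cong (unshift i j) eq ⟩
    unshift i j (shift i j p′)    ≡⟨ unshift-shift p′ ⟩
    p′                            ∎

  shift-unshift : ∀ {q} → q ≢ suc i → q ≢ suc (suc j) → shift i j (unshift i j q) ≡ q
  shift-unshift {q} q≢1+i q≢2+j with region i (suc j) q
  ... | below q≤i rewrite unshift-below q≤i = shift-below q≤i
  shift-unshift {suc r} q≢1+i _ | between (s≤s i≤r) (s≤s r≤j)
    rewrite unshift-between i≤r r≤j = shift-between (≤∧≢⇒< i≤r (q≢1+i ∘′ cong suc ∘′ sym)) r≤j
  shift-unshift {suc (suc r)} _ q≢2+j | above (s≤s (s≤s j≤r))
    rewrite unshift-above j≤r = shift-above (≤∧≢⇒< j≤r (q≢2+j ∘′ cong (suc ∘′ suc) ∘′ sym))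

  unshift-< : ∀ {n q} → j < n → q < suc (suc n) → unshift i j q < n
  unshift-< {q = q} j<n q<2+n with region i (suc j) q
  unshift-< {q = q} j<n q<2+n | below q≤i rewrite unshift-below q≤i = ≤-<-trans (≤-trans q≤i i≤j) j<n
  unshift-< {q = suc r} j<n _ | between (s≤s i≤r) (s≤s r≤j) rewrite unshift-between i≤r r≤j = ≤-<-trans r≤j j<n
  unshift-< {q = suc (suc r)} _ (s≤s (s≤s r<n)) | above (s≤s (s≤s j≤r)) rewrite unshift-above j≤r = r<n

  addChord-1+i : ∀ f → addChord i j f (suc i) ≡ suc (suc j)
  addChord-1+i f rewrite ≡ᵇ-true {suc i} refl = refl

  addChord-2+j : ∀ f → addChord i j f (suc (suc j)) ≡ suc i
  addChord-2+j f rewrite ≡ᵇ-false (>⇒≢ (s≤s (s≤s i≤j))) | ≡ᵇ-true {suc (suc j)} refl = refl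

  addChord-old : ∀ f {q} → q ≢ suc i → q ≢ suc (suc j) → addChord i j f q ≡ shift i j (f (unshift i j q))
  addChord-old f q≢1+i q≢2+j rewrite ≡ᵇ-false q≢1+i | ≡ᵇ-false q≢2+j = refl

  addChord-shift : ∀ f p → addChord i j f (shift i j p) ≡ shift i j (f p)
  addChord-shift f p = begin
    addChord i j f (shift i j p)            ≡⟨ addChord-old f (shift≢1+i p) (shift≢2+j p) ⟩
    shift i j (f (unshift i j (shift i j p))) ≡⟨ cong (shift i j ∘′ f) (unshift-shift p) ⟩
    shift i j (f p)                          ∎

module PerfectMatching {n g} (G : IsPerfectMatchingOn n g) where

  partner-< : ∀ {p} → p < n → g p < n
  partner-< p<n = proj₁ (G _ p<n)

  partner-≢ : ∀ {p} → p < n → g p ≢ p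
  partner-≢ p<n = proj₁ (proj₂ (G _ p<n))

  partner-involutive : ∀ {p} → p < n → g (g p) ≡ p
  partner-involutive p<n = proj₂ (proj₂ (G _ p<n))

  partner-swap : ∀ {p q} → p < n → q < n → g p ≡ q ⇔ g q ≡ p
  partner-swap = involution-swap partner-involutive

  partner-injective : ∀ {p q} → p < n → q < n → g p ≡ g q → p ≡ q
  partner-injective {p} {q} p<n q<n eq = begin
    p       ≡⟨ partner-involutive p<n ⟨
    g (g p) ≡⟨ cong g eq ⟩
    g (g q) ≡⟨ partner-involutive q<n ⟩
    q       ∎

Agree : ℕ → PartnerMap → PartnerMap → Set
Agree n f g = ∀ {p} → p < n → f p ≡ g p

agree? : ∀ n f g → Dec (Agree n f g)
agree? n f g = allUpTo? (λ p → f p ≟ g p) n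

removeChord : ℕ → ℕ → PartnerMap → PartnerMap
removeChord i j g p = unshift i j (g (shift i j p))

module _ {i j n : ℕ} (i≤j : i ≤ j) (j<n : j < n) where

  private
    1+i<2+j : suc i < suc (suc j)
    1+i<2+j = s≤s (s≤s i≤j)

    1+i<2+n : suc i < suc (suc n)
    1+i<2+n = <-trans 1+i<2+j (s≤s (s≤s j<n))

    2+j<2+n : suc (suc j) < suc (suc n)
    2+j<2+n = s≤s (s≤s j<n)

  addChord-perfect : ∀ {f} → IsPerfectMatchingOn n f → IsPerfectMatchingOn (suc (suc n)) (addChord i j f)
  addChord-perfect {f} F q q<2+n with q ≟ suc i | q ≟ suc (suc j)
  ... | yes refl | _ rewrite addChord-1+i i≤j f | addChord-2+j i≤j f = 2+j<2+n , >⇒≢ 1+i<2+j , refl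
  ... | no _ | yes refl rewrite addChord-2+j i≤j f | addChord-1+i i≤j f = 1+i<2+n , <⇒≢ 1+i<2+j , refl
  ... | no q≢1+i | no q≢2+j rewrite addChord-old i≤j f q≢1+i q≢2+j =
      shift-< i≤j (partner-< p<n)
    , (λ eq → partner-≢ p<n (shift-injective i≤j (trans eq (sym shift-p≡q))))
    , (begin
        addChord i j f (shift i j (f p)) ≡⟨ addChord-shift i≤j f (f p) ⟩
        shift i j (f (f p))              ≡⟨ cong (shift i j) (partner-involutive p<n) ⟩
        shift i j p                      ≡⟨ shift-p≡q ⟩
        q                                ∎)
    where
    open PerfectMatching F
    p = unshift i j q
    p<n : p < n
    p<n = unshift-< i≤j j<n q<2+n
    shift-p≡q : shift i j p ≡ q
    shift-p≡q = shift-unshift i≤j q≢1+i q≢2+j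

  module _ {g} (G : IsPerfectMatchingOn (suc (suc n)) g) (chord : g (suc i) ≡ suc (suc j)) where
    open PerfectMatching G

    chord′ : g (suc (suc j)) ≡ suc i
    chord′ = trans (cong g (sym chord)) (partner-involutive 1+i<2+n)

    partner≢1+i : ∀ {q} → q < suc (suc n) → q ≢ suc (suc j) → g q ≢ suc i
    partner≢1+i q< q≢2+j eq = q≢2+j (partner-injective q< 2+j<2+n (trans eq (sym chord′)))

    partner≢2+j : ∀ {q} → q < suc (suc n) → q ≢ suc i → g q ≢ suc (suc j)
    partner≢2+j q< q≢1+i eq = q≢1+i (partner-injective q< 1+i<2+n (trans eq (sym chord)))

    shift-unshift-partner : ∀ {q} → q < suc (suc n) → q ≢ suc i → q ≢ suc (suc j) →
                            shift i j (unshift i j (g q)) ≡ g q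
    shift-unshift-partner q< q≢1+i q≢2+j = shift-unshift i≤j (partner≢1+i q< q≢2+j) (partner≢2+j q< q≢1+i)

    removeChord-perfect : IsPerfectMatchingOn n (removeChord i j g)
    removeChord-perfect p p<n =
        unshift-< i≤j j<n (partner-< q<)
      , (λ eq → partner-≢ q< (trans (sym g-q) (cong (shift i j) eq)))
      , (begin
          unshift i j (g (shift i j (unshift i j (g q)))) ≡⟨ cong (unshift i j ∘′ g) g-q ⟩
          unshift i j (g (g q))                           ≡⟨ cong (unshift i j) (partner-involutive q<) ⟩
          unshift i j q                                   ≡⟨ unshift-shift i≤j p ⟩
          p                                               ∎)
      where
      q = shift i j p
      q< : q < suc (suc n)
      q< = shift-< i≤j p<n
      g-q : shift i j (unshift i j (g q)) ≡ g q
      g-q = shift-unshift-partner q< (shift≢1+i i≤j p) (shift≢2+j i≤j p)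

  agree-addChord⇔ : ∀ {f g} → IsPerfectMatchingOn (suc (suc n)) g →
                    Agree (suc (suc n)) (addChord i j f) g ⇔
                    (g (suc i) ≡ suc (suc j) × Agree n f (removeChord i j g))
  agree-addChord⇔ {f} {g} G = mk⇔ to from
    where
    to : Agree (suc (suc n)) (addChord i j f) g → g (suc i) ≡ suc (suc j) × Agree n f (removeChord i j g)
    to A = trans (sym (A 1+i<2+n)) (addChord-1+i i≤j f) , λ {p} p<n → begin
      f p                                        ≡⟨ unshift-shift i≤j (f p) ⟨
      unshift i j (shift i j (f p))              ≡⟨ cong (unshift i j) (addChord-shift i≤j f p) ⟨
      unshift i j (addChord i j f (shift i j p)) ≡⟨ cong (unshift i j) (A (shift-< i≤j p<n)) ⟩
      unshift i j (g (shift i j p))              ∎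

    from : g (suc i) ≡ suc (suc j) × Agree n f (removeChord i j g) → Agree (suc (suc n)) (addChord i j f) g
    from (chord , A) {q} q< with q ≟ suc i | q ≟ suc (suc j)
    ... | yes refl | _        = trans (addChord-1+i i≤j f) (sym chord)
    ... | no _     | yes refl = trans (addChord-2+j i≤j f) (sym (chord′ G chord))
    ... | no q≢1+i | no q≢2+j = begin
      addChord i j f q                                        ≡⟨ addChord-old i≤j f q≢1+i q≢2+j ⟩
      shift i j (f (unshift i j q))                           ≡⟨ cong (shift i j) (A (unshift-< i≤j j<n q<)) ⟩
      shift i j (unshift i j (g (shift i j (unshift i j q)))) ≡⟨ cong (shift i j ∘′ unshift i j ∘′ g) (shift-unshift i≤j q≢1+i q≢2+j) ⟩
      shift i j (unshift i j (g q))                           ≡⟨ shift-unshift-partner G chord q< q≢1+i q≢2+j ⟩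
      g q                                                     ∎

multiplicity : ℕ → PartnerMap → List PartnerMap → ℕ
multiplicity n g fs = ∑[ f ∈ fs ] 𝟙 (agree? n f g)

extend : ℕ → List PartnerMap → List PartnerMap
extend n fs = concatMap (λ f → map (λ c → addChord (proj₁ c) (proj₂ c) f) (choices n)) fs

-- The chords {1+i , 2+j} of g with i ≤ j < n, i.e. those not at the reference endpoint 0.
chordsAvoiding0 : ℕ → PartnerMap → ℕ
chordsAvoiding0 n g = ∑[ j < n ] ∑[ i < suc j ] 𝟙 (g (suc i) ≟ suc (suc j))

choices-ordered : ∀ n → All (λ c → proj₁ c ≤ proj₂ c × proj₂ c < n) (choices n)
choices-ordered n = concat⁺ (map⁺ (applyUpTo⁺₁ id n λ j<n →
  map⁺ (applyUpTo⁺₁ id _ λ i<1+j → s≤s⁻¹ i<1+j , j<n)))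

∑∈-choices : ∀ n (h : ℕ × ℕ → ℕ) → ∑∈ (choices n) h ≡ ∑[ j < n ] ∑[ i < suc j ] h (i , j)
∑∈-choices n h = begin
  ∑∈ (choices n) h
    ≡⟨ ∑∈-concatMap _ (upTo n) h ⟩
  ∑[ j ∈ upTo n ] ∑∈ (map (λ i → (i , j)) (upTo (suc j))) h
    ≡⟨ ∑∈-cong (upTo n) (λ j → trans (∑∈-map _ (upTo (suc j)) h) (∑∈-applyUpTo _ (suc j) _)) ⟩
  ∑[ j ∈ upTo n ] ∑[ i < suc j ] h (i , j)
    ≡⟨ ∑∈-applyUpTo _ n _ ⟩
  ∑[ j < n ] ∑[ i < suc j ] h (i , j) ∎

extend-perfect : ∀ n {fs} → All (IsPerfectMatchingOn n) fs → All (IsPerfectMatchingOn (suc (suc n))) (extend n fs)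
extend-perfect n = concat⁺ ∘′ map⁺ ∘′ All.map λ F →
  map⁺ (All.map (λ (i≤j , j<n) → addChord-perfect i≤j j<n F) (choices-ordered n))

module _ {n} (fs : List PartnerMap) {c} (mult : ∀ h → IsPerfectMatchingOn n h → multiplicity n h fs ≡ c)
         {g} (G : IsPerfectMatchingOn (suc (suc n)) g) where

  multiplicity-addChord : ∀ {i j} → i ≤ j → j < n →
    ∑[ f ∈ fs ] 𝟙 (agree? (suc (suc n)) (addChord i j f) g) ≡ 𝟙 (g (suc i) ≟ suc (suc j)) * c
  multiplicity-addChord {i} {j} i≤j j<n = begin
    ∑[ f ∈ fs ] 𝟙 (agree? (suc (suc n)) (addChord i j f) g)
      ≡⟨ ∑∈-cong fs (λ f → 𝟙-cong _ (chord? ×-dec _) (agree-addChord⇔ i≤j j<n G)) ⟩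
    ∑[ f ∈ fs ] 𝟙 (chord? ×-dec agree? n f (removeChord i j g))
      ≡⟨ ∑∈-cong fs (λ f → 𝟙-× chord? _) ⟩
    ∑[ f ∈ fs ] (𝟙 chord? * 𝟙 (agree? n f (removeChord i j g)))
      ≡⟨ ∑∈-distribˡ-* fs (𝟙 chord?) _ ⟩
    𝟙 chord? * multiplicity n (removeChord i j g) fs
      ≡⟨ multiplicity-removeChord chord? ⟩
    𝟙 chord? * c ∎
    where
    chord? = g (suc i) ≟ suc (suc j)
    multiplicity-removeChord : (e : Dec (g (suc i) ≡ suc (suc j))) →
                               𝟙 e * multiplicity n (removeChord i j g) fs ≡ 𝟙 e * c
    multiplicity-removeChord (yes chord) = cong (1 *_) (mult _ (removeChord-perfect i≤j j<n G chord))
    multiplicity-removeChord (no _)      = refl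

  multiplicity-extend : multiplicity (suc (suc n)) g (extend n fs) ≡ chordsAvoiding0 n g * c
  multiplicity-extend = begin
    multiplicity (suc (suc n)) g (extend n fs)
      ≡⟨ ∑∈-concatMap _ fs _ ⟩
    ∑[ f ∈ fs ] ∑∈ (map (λ c → addChord (proj₁ c) (proj₂ c) f) (choices n)) (λ f′ → 𝟙 (agree? _ f′ g))
      ≡⟨ ∑∈-cong fs (λ f → trans (∑∈-map _ (choices n) _) (∑∈-choices n _)) ⟩
    ∑[ f ∈ fs ] ∑[ j < n ] ∑[ i < suc j ] 𝟙 (agree? _ (addChord i j f) g)
      ≡⟨ ∑∈-∑<-comm fs n _ ⟩
    ∑[ j < n ] ∑[ f ∈ fs ] ∑[ i < suc j ] 𝟙 (agree? _ (addChord i j f) g)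
      ≡⟨ ∑<-cong n (λ {j} _ → ∑∈-∑<-comm fs (suc j) _) ⟩
    ∑[ j < n ] ∑[ i < suc j ] ∑[ f ∈ fs ] 𝟙 (agree? _ (addChord i j f) g)
      ≡⟨ ∑<-cong n (λ j<n → ∑<-cong _ (λ i<1+j → multiplicity-addChord (s≤s⁻¹ i<1+j) j<n)) ⟩
    ∑[ j < n ] ∑[ i < suc j ] (𝟙 (g (suc i) ≟ suc (suc j)) * c)
      ≡⟨ ∑<-cong n (λ {j} _ → ∑<-distribʳ-* (suc j) _ c) ⟩
    ∑[ j < n ] (∑[ i < suc j ] 𝟙 (g (suc i) ≟ suc (suc j)) * c)
      ≡⟨ ∑<-distribʳ-* n _ c ⟩
    chordsAvoiding0 n g * c ∎

module _ {N g} (G : IsPerfectMatchingOn N g) where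
  open PerfectMatching G

  ∑<-reindex-partner : ∀ F → ∑[ b < N ] F (g b) ≡ ∑< N F
  ∑<-reindex-partner = ∑<-reindex-involution N partner-< partner-involutive

  2*rightEndpoints : 2 * ∑[ b < N ] 𝟙 (g b <? b) ≡ N
  2*rightEndpoints = begin
    2 * R                                         ≡⟨ cong (R +_) (+-identityʳ R) ⟩
    R + R                                         ≡⟨ cong (R +_) (∑<-reindex-partner λ b → 𝟙 (g b <? b)) ⟨
    R + ∑[ b < N ] 𝟙 (g (g b) <? g b)             ≡⟨ cong (R +_) (∑<-cong N λ b<N → cong (λ x → 𝟙 (x <? g _)) (partner-involutive b<N)) ⟩
    R + ∑[ b < N ] 𝟙 (b <? g b)                   ≡⟨ ∑<-distrib-+ N _ _ ⟨
    ∑[ b < N ] (𝟙 (g b <? b) + 𝟙 (b <? g b))      ≡⟨ ∑<-cong N (λ b<n → 𝟙-trichotomy (partner-≢ b<n)) ⟩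
    ∑[ b < N ] 1                                  ≡⟨ ∑<-one N ⟩
    N                                             ∎
    where R = ∑[ b < N ] 𝟙 (g b <? b)

module _ {n g} (G : IsPerfectMatchingOn (suc (suc n)) g) where
  open PerfectMatching G

  private
    N = suc (suc n)

    -- A chord {a , b} with 0 < a < b is counted at its right endpoint b.
    smallerPartners : ℕ → ℕ
    smallerPartners b = ∑[ i < pred b ] 𝟙 (g b ≟ suc i)

    chordsAvoiding0≡ : chordsAvoiding0 n g ≡ ∑< N smallerPartners
    chordsAvoiding0≡ = begin
      chordsAvoiding0 n g
        ≡⟨ ∑<-cong n (λ j<n → ∑<-cong _ (λ i<1+j → 𝟙-cong _ _ (partner-swap (1+i<N i<1+j j<n) (s≤s (s≤s j<n))))) ⟩
      ∑[ j < n ] smallerPartners (suc (suc j))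
        ≡⟨ trans (∑<-suc (suc n) smallerPartners) (∑<-suc n (smallerPartners ∘′ suc)) ⟨
      ∑< N smallerPartners ∎
      where
      1+i<N : ∀ {i j} → i < suc j → j < n → suc i < N
      1+i<N (s≤s i≤j) j<n = s≤s (s≤s (≤-trans i≤j (<⇒≤ j<n)))

    rightEndpoint≡ : ∀ {b} → b < N → 𝟙 (g b <? b) ≡ 𝟙 (g b ≟ 0) + smallerPartners b
    rightEndpoint≡ {zero}  0<N = sym (cong (_+ 0) (𝟙-no (g 0 ≟ 0) (partner-≢ 0<N)))
    rightEndpoint≡ {suc t} _   = trans (sym (∑<-count (suc t) (g (suc t)))) (∑<-suc t _)

    partnerOf0 : ∑[ b < N ] 𝟙 (g b ≟ 0) ≡ 1
    partnerOf0 = begin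
      ∑[ b < N ] 𝟙 (g b ≟ 0) ≡⟨ ∑<-cong N (λ b<N → 𝟙-cong _ _ (partner-swap b<N z<s)) ⟩
      ∑[ b < N ] 𝟙 (g 0 ≟ b) ≡⟨ ∑<-count N (g 0) ⟩
      𝟙 (g 0 <? N)           ≡⟨ 𝟙-yes (g 0 <? N) (partner-< z<s) ⟩
      1                      ∎

  2*chordsAvoiding0 : 2 * chordsAvoiding0 n g ≡ n
  2*chordsAvoiding0 = +-cancelˡ-≡ 2 _ _ (begin
    2 + 2 * C                                           ≡⟨ *-suc 2 C ⟨
    2 * suc C                                           ≡⟨ cong (λ x → 2 * suc x) chordsAvoiding0≡ ⟩
    2 * (1 + ∑< N smallerPartners)                      ≡⟨ cong (λ x → 2 * (x + ∑< N smallerPartners)) partnerOf0 ⟨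
    2 * (∑[ b < N ] 𝟙 (g b ≟ 0) + ∑< N smallerPartners) ≡⟨ cong (2 *_) (∑<-distrib-+ N _ _) ⟨
    2 * ∑[ b < N ] (𝟙 (g b ≟ 0) + smallerPartners b)    ≡⟨ cong (2 *_) (∑<-cong N rightEndpoint≡) ⟨
    2 * ∑[ b < N ] 𝟙 (g b <? b)                         ≡⟨ 2*rightEndpoints G ⟩
    N                                                   ∎)
    where C = chordsAvoiding0 n g

initial-perfect : IsPerfectMatchingOn 2 initial
initial-perfect zero          _ = s≤s (s≤s z≤n) , (λ ()) , refl
initial-perfect (suc zero)    _ = s≤s z≤n , (λ ()) , refl
initial-perfect (suc (suc p)) (s≤s (s≤s ()))

agree-initial : ∀ {g} → IsPerfectMatchingOn 2 g → Agree 2 initial g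
agree-initial {g} G {zero} 0<2 with g 0 | PerfectMatching.partner-< G 0<2 | PerfectMatching.partner-≢ G 0<2
... | zero        | _              | g0≢0 = ⊥-elim (g0≢0 refl)
... | suc zero    | _              | _    = refl
... | suc (suc _) | s≤s (s≤s ())   | _
agree-initial {g} G {suc zero} 1<2 with g 1 | PerfectMatching.partner-< G 1<2 | PerfectMatching.partner-≢ G 1<2
... | zero        | _              | _    = refl
... | suc zero    | _              | g1≢1 = ⊥-elim (g1≢1 refl)
... | suc (suc _) | s≤s (s≤s ())   | _
agree-initial G {suc (suc _)} (s≤s (s≤s ()))

outcomes-perfect : ∀ m → All (IsPerfectMatchingOn (2 * suc m)) (outcomes (suc m))
outcomes-perfect zero    = initial-perfect All.∷ All.[]
outcomes-perfect (suc m) = subst (λ N → All (IsPerfectMatchingOn N) (outcomes (suc (suc m))))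
                                 (sym (*-suc 2 (suc m))) (extend-perfect (2 * suc m) (outcomes-perfect m))

multiplicity-outcomes : ∀ m g → IsPerfectMatchingOn (2 * suc m) g → multiplicity (2 * suc m) g (outcomes (suc m)) ≡ m !
multiplicity-outcomes zero    g G = cong (_+ 0) (𝟙-yes (agree? 2 initial g) (agree-initial G))
multiplicity-outcomes (suc m) g G = begin
  multiplicity (2 * suc (suc m)) g (outcomes (suc (suc m))) ≡⟨ cong (λ N → multiplicity N g (extend n O)) 2k≡2+n ⟩
  multiplicity (2 + n) g (extend n O)                       ≡⟨ multiplicity-extend O (multiplicity-outcomes m) G′ ⟩
  chordsAvoiding0 n g * m !                                 ≡⟨ cong (_* m !) chordsAvoiding0≡1+m ⟩
  suc m * m !                                               ∎
  where
  n = 2 * suc m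
  O = outcomes (suc m)
  2k≡2+n : 2 * suc (suc m) ≡ 2 + n
  2k≡2+n = *-suc 2 (suc m)
  G′ : IsPerfectMatchingOn (2 + n) g
  G′ = subst (λ N → IsPerfectMatchingOn N g) 2k≡2+n G
  chordsAvoiding0≡1+m : chordsAvoiding0 n g ≡ suc m
  chordsAvoiding0≡1+m = *-cancelˡ-≡ _ _ 2 (2*chordsAvoiding0 G′)

module _ (k : ℕ) (D : ChordDiagram k) where
  private
    d = proj₁ D

  partnerMap : PartnerMap
  partnerMap p with p <? 2 * k
  ... | yes p<2k = toℕ (d (fromℕ< p<2k))
  ... | no _     = 0

  partnerMap-< : ∀ {p} (p<2k : p < 2 * k) → partnerMap p ≡ toℕ (d (fromℕ< p<2k))
  partnerMap-< {p} p<2k with p <? 2 * k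
  ... | yes _    = refl
  ... | no p≮2k = ⊥-elim (p≮2k p<2k)

  partnerMap-toℕ : ∀ x → partnerMap (toℕ x) ≡ toℕ (d x)
  partnerMap-toℕ x = trans (partnerMap-< (toℕ<n x)) (cong (toℕ ∘′ d) (fromℕ<-toℕ x (toℕ<n x)))

  partnerMap-perfect : IsPerfectMatchingOn (2 * k) partnerMap
  partnerMap-perfect p p<2k =
      subst (_< 2 * k) (sym (partnerMap-< p<2k)) (toℕ<n (d x))
    , (λ eq → proj₂ (proj₂ D) x (toℕ-injective (trans (sym (partnerMap-< p<2k)) (trans eq (sym (toℕ-fromℕ< p<2k))))))
    , (begin
        partnerMap (partnerMap p)  ≡⟨ cong partnerMap (partnerMap-< p<2k) ⟩
        partnerMap (toℕ (d x))     ≡⟨ partnerMap-toℕ (d x) ⟩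
        toℕ (d (d x))              ≡⟨ cong toℕ (proj₁ (proj₂ D) x) ⟩
        toℕ x                      ≡⟨ toℕ-fromℕ< p<2k ⟩
        p                          ∎)
    where x = fromℕ< p<2k

  realises⇔agree : ∀ f → Realises k D f ⇔ Agree (2 * k) f partnerMap
  realises⇔agree f = mk⇔
    (λ R {p} p<2k → begin
      f p                        ≡⟨ cong f (toℕ-fromℕ< p<2k) ⟨
      f (toℕ (fromℕ< p<2k))      ≡⟨ R (fromℕ< p<2k) ⟩
      toℕ (d (fromℕ< p<2k))      ≡⟨ partnerMap-< p<2k ⟨
      partnerMap p               ∎)
    (λ A x → trans (A (toℕ<n x)) (partnerMap-toℕ x))

  count≡multiplicity : count k D ≡ multiplicity (2 * k) partnerMap (outcomes k)
  count≡multiplicity = trans (length-filter (realises? k D) (outcomes k))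
    (∑∈-cong (outcomes k) λ f → 𝟙-cong (realises? k D f) (agree? (2 * k) f partnerMap) (realises⇔agree f))

count-≡-factorial : ∀ m (D : ChordDiagram (suc m)) → count (suc m) D ≡ m !
count-≡-factorial m D =
  trans (count≡multiplicity (suc m) D) (multiplicity-outcomes m (partnerMap (suc m) D) (partnerMap-perfect (suc m) D))

mainTheorem15 : (k : ℕ) → 1 ≤ k →
    All (IsPerfectMatchingOn (2 * k)) (outcomes k)
    × ((D D′ : ChordDiagram k) → count k D ≡ count k D′)
mainTheorem15 (suc m) _ =
  outcomes-perfect m , λ D D′ → trans (count-≡-factorial m D) (sym (count-≡-factorial m D′))
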